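{- Let $\varphi$ be a formula, $x$ a variable, and $y$ a variable which does not occur in $\varphi$. Then (a) $\vdash_Q\varphi\mathbin{\dot{ - }}\varphi\{y/x\}$ and (b) $\vdash_Q\varphi\{y/x\}\mathbin{\dot{ - }}\varphi$.
   Context: $\mathcal{L}$ is a continuous signature: a nonempty set $\mathcal{R}$ of relation symbols, a set $\mathcal{F}$ of function symbols disjoint from $\mathcal{R}$, arities $n_s<\omega$, and functions $\delta_{s,i}:(0,1]\to(0,1]$ for $i<n_s$; possibly with a distinguished binary relation symbol $d$ (metric). Formulae: $Pt_0\cdots t_{n_P-1}$, $\varphi\mathbin{\dot{ - }}\psi$, $\neg\varphi$, $\tfrac12\varphi$, $\sup_x\varphi$. $\varphi[t/x]$ is free substitution of the term $t$ for $x$, correct if no variable of $t$ becomes bound. The bound substitution $\varphi\{y/x\}$ is the result of replacing each subformula $\sup_x\alpha$ of $\varphi$ by $\sup_y\alpha[y/x]$. Abbreviations: $\varphi\wedge\psi:=\varphi\mathbin{\dot{ - }}(\varphi\mathbin{\dot{ - }}\psi)$, $1:=\neg(\varphi\mathbin{\dot{ - }}\varphi)$, dyadic rationals $\mathbb{D}$ as formulas built from $1$ by $\neg,\mathbin{\dot{ - }},\tfrac12$. Proof system. Axioms: all generalizations $\sup_{x_1}\cdots\sup_{x_n}\chi$ ($n\ge0$) of instances of (A1) $(\varphi\mathbin{\dot{ - }}\psi)\mathbin{\dot{ - }}\varphi$; (A2) $((\chi\mathbin{\dot{ - }}\varphi)\mathbin{\dot{ - }}(\chi\mathbin{\dot{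 - }}\psi))\mathbin{\dot{ - }}(\psi\mathbin{\dot{ - }}\varphi)$; (A3) $(\varphi\mathbin{\dot{ - }}(\varphi\mathbin{\dot{ - }}\psi))\mathbin{\dot{ - }}(\psi\mathbin{\dot{ - }}(\psi\mathbin{\dot{ - }}\varphi))$; (A4) $(\varphi\mathbin{\dot{ - }}\psi)\mathbin{\dot{ - }}(\neg\psi\mathbin{\dot{ - }}\neg\varphi)$; (A5) $\tfrac12\varphi\mathbin{\dot{ - }}(\varphi\mathbin{\dot{ - }}\tfrac12\varphi)$; (A6) $(\varphi\mathbin{\dot{ - }}\tfrac12\varphi)\mathbin{\dot{ - }}\tfrac12\varphi$; (A7) $(\sup_x\psi\mathbin{\dot{ - }}\sup_x\varphi)\mathbin{\dot{ - }}\sup_x(\psi\mathbin{\dot{ - }}\varphi)$; (A8) $\varphi[t/x]\mathbin{\dot{ - }}\sup_x\varphi$ (correct substitution); (A9) $\sup_x\varphi\mathbin{\dot{ - }}\varphi$ ($x$ not free in $\varphi$); with a metric also (A10) $dxx$; (A11) $dxy\mathbin{\dot{ - }}dyx$; (A12) $(dxz\mathbin{\dot{ - }}dxy)\mathbin{\dot{ - }}dyz$; (A13) $(q\mathbin{\dot{ - }}dzw)\wedge(d\,f\bar xz\bar y\,f\bar xw\bar y\mathbin{\dot{ - }}r)$ for $f\in\mathcal{F}$, $|\bar x|=i<n_f$, $\epsilon\in(0,1]$, $r,q\in\mathbb{D}$, $r>\epsilon$, $q<\delta_{f,i}(\epsilon)$; (A14) $(q\mathbin{\dot{ - }}dzw)\wedge((P\bar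 xz\bar y\mathbin{\dot{ - }}P\bar xw\bar y)\mathbin{\dot{ - }}r)$ analogously for $P\in\mathcal{R}$. Sole rule: modus ponens (from $\varphi$ and $\psi\mathbin{\dot{ - }}\varphi$ infer $\psi$). $\vdash_Q\varphi$ means $\varphi$ has a finite derivation from the axioms. -}

module Defs where

open import Data.Nat using (ℕ; _≟_)
open import Data.Fin using (Fin)
open import Data.Vec using (Vec; []; _∷_; _[_]≔_; map)
open import Data.List using (List; []; _∷_)
open import Data.Maybe using (Maybe; just)
open import Data.Product using (Σ; _,_)
open import Relation.Nullary using (¬_; yes; no)
open import Relation.Binary.PropositionalEquality using (_≡_; subst; sym)
open import Data.Rational using (ℚ; 0ℚ; 1ℚ; _-_; _*_; _⊔_; ½)

Var : Set
Var = ℕ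

-- The moduli δ_{s,i} : (0,1] → (0,1] are real functions; they only enter the
-- proof system through axioms (A13)/(A14), via the condition on dyadic r, q:
--   "there is ε ∈ (0,1] with r > ε and q < δ_{s,i}(ε)".
-- Since there are no reals available, this condition is recorded abstractly as
-- the predicates admF / admR  (admX s i r q  :=  ∃ ε ∈ (0,1]. r > ε ∧ q < δ_{s,i}(ε)).
record Signature : Set₁ where
  field
    Rel     : Set
    Fun     : Set
    someRel : Rel
    arityR  : Rel → ℕ
    arityF  : Fun → ℕ
    metric  : Maybe (Σ Rel λ d → arityR d ≡ 2)
    admF    : (f : Fun) → Fin (arityF f) → ℚ → ℚ → Set
    admR    : (P : Rel) → Fin (arityR P) → ℚ → ℚ → Set

module Syntax (S : Signature) where
  open Signature S

  data Term : Set where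
    var : Var → Term
    app : (f : Fun) → Vec Term (arityF f) → Term

  mutual
    substT : Term → Var → Term → Term
    substT t x (var z) with z ≟ x
    ... | yes _ = t
    ... | no  _ = var z
    substT t x (app f ts) = app f (substTs t x ts)

    substTs : ∀ {n} → Term → Var → Vec Term n → Vec Term n
    substTs t x []       = []
    substTs t x (s ∷ ss) = substT t x s ∷ substTs t x ss

  data _∈T_ (y : Var) : Term → Set
  data _∈Ts_ (y : Var) : ∀ {n} → Vec Term n → Set

  data _∈T_ y where
    here  : y ∈T var y
    inApp : ∀ {f ts} → y ∈Ts ts → y ∈T app f ts

  data _∈Ts_ y where
    hd : ∀ {n t} {ts : Vec Term n} → y ∈T t → y ∈Ts (t ∷ ts)
    tl : ∀ {n t} {ts : Vec Term n} → y ∈Ts ts → y ∈Ts (t ∷ ts)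

  infixl 6 _∸_
  data Formula : Set where
    rel  : (P : Rel) → Vec Term (arityR P) → Formula
    _∸_  : Formula → Formula → Formula
    neg  : Formula → Formula
    half : Formula → Formula
    sup  : Var → Formula → Formula

  _∧_ : Formula → Formula → Formula
  φ ∧ ψ = φ ∸ (φ ∸ ψ)

  data FreeIn (x : Var) : Formula → Set where
    fRel  : ∀ {P ts} → x ∈Ts ts → FreeIn x (rel P ts)
    fMinL : ∀ {φ ψ} → FreeIn x φ → FreeIn x (φ ∸ ψ)
    fMinR : ∀ {φ ψ} → FreeIn x ψ → FreeIn x (φ ∸ ψ)
    fNeg  : ∀ {φ} → FreeIn x φ → FreeIn x (neg φ)
    fHalf : ∀ {φ} → FreeIn x φ → FreeIn x (half φ)
    fSup  : ∀ {y φ} → ¬ (y ≡ x) → FreeIn x φ → FreeIn x (sup y φ)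

  data Occurs (y : Var) : Formula → Set where
    oRel  : ∀ {P ts} → y ∈Ts ts → Occurs y (rel P ts)
    oMinL : ∀ {φ ψ} → Occurs y φ → Occurs y (φ ∸ ψ)
    oMinR : ∀ {φ ψ} → Occurs y ψ → Occurs y (φ ∸ ψ)
    oNeg  : ∀ {φ} → Occurs y φ → Occurs y (neg φ)
    oHalf : ∀ {φ} → Occurs y φ → Occurs y (half φ)
    oBind : ∀ {φ} → Occurs y (sup y φ)
    oSup  : ∀ {z φ} → Occurs y φ → Occurs y (sup z φ)

  _[_/_] : Formula → Term → Var → Formula
  rel P ts [ t / x ] = rel P (substTs t x ts)
  (φ ∸ ψ)  [ t / x ] = (φ [ t / x ]) ∸ (ψ [ t / x ])
  neg φ    [ t / x ] = neg (φ [ t / x ])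
  half φ   [ t / x ] = half (φ [ t / x ])
  sup y φ  [ t / x ] with y ≟ x
  ... | yes _ = sup y φ
  ... | no  _ = sup y (φ [ t / x ])

  data Substitutable (t : Term) (x : Var) : Formula → Set where
    sRel     : ∀ {P ts} → Substitutable t x (rel P ts)
    sMin     : ∀ {φ ψ} → Substitutable t x φ → Substitutable t x ψ → Substitutable t x (φ ∸ ψ)
    sNeg     : ∀ {φ} → Substitutable t x φ → Substitutable t x (neg φ)
    sHalf    : ∀ {φ} → Substitutable t x φ → Substitutable t x (half φ)
    sSupSame : ∀ {φ} → Substitutable t x (sup x φ)
    sSupNF   : ∀ {y φ} → ¬ FreeIn x φ → Substitutable t x (sup y φ)
    sSup     : ∀ {y φ} → ¬ (y ∈T t) → Substitutable t x φ → Substitutable t x (sup y φ)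

  _⟪_/_⟫ : Formula → Var → Var → Formula
  rel P ts ⟪ y / x ⟫ = rel P ts
  (φ ∸ ψ)  ⟪ y / x ⟫ = (φ ⟪ y / x ⟫) ∸ (ψ ⟪ y / x ⟫)
  neg φ    ⟪ y / x ⟫ = neg (φ ⟪ y / x ⟫)
  half φ   ⟪ y / x ⟫ = half (φ ⟪ y / x ⟫)
  sup z α  ⟪ y / x ⟫ with z ≟ x
  ... | yes _ = sup y ((α ⟪ y / x ⟫) [ var y / x ])
  ... | no  _ = sup z (α ⟪ y / x ⟫)

  -- dyadic-rational formulas (built from 1 := ¬(φ ∸ φ)) together with their value
  data Dyadic : Formula → ℚ → Set where
    one   : ∀ φ → Dyadic (neg (φ ∸ φ)) 1ℚ
    dNeg  : ∀ {a v} → Dyadic a v → Dyadic (neg a) (1ℚ - v)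
    dMin  : ∀ {a b v w} → Dyadic a v → Dyadic b w → Dyadic (a ∸ b) ((v - w) ⊔ 0ℚ)
    dHalf : ∀ {a v} → Dyadic a v → Dyadic (half a) (½ * v)

  dist : Σ Rel (λ d → arityR d ≡ 2) → Term → Term → Formula
  dist (d , eq) t u = rel d (subst (Vec Term) (sym eq) (t ∷ u ∷ []))

  data Instance : Formula → Set where
    A1 : ∀ φ ψ → Instance ((φ ∸ ψ) ∸ φ)
    A2 : ∀ φ ψ χ → Instance (((χ ∸ φ) ∸ (χ ∸ ψ)) ∸ (ψ ∸ φ))
    A3 : ∀ φ ψ → Instance ((φ ∸ (φ ∸ ψ)) ∸ (ψ ∸ (ψ ∸ φ)))
    A4 : ∀ φ ψ → Instance ((φ ∸ ψ) ∸ (neg ψ ∸ neg φ))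
    A5 : ∀ φ → Instance (half φ ∸ (φ ∸ half φ))
    A6 : ∀ φ → Instance ((φ ∸ half φ) ∸ half φ)
    A7 : ∀ x φ ψ → Instance ((sup x ψ ∸ sup x φ) ∸ sup x (ψ ∸ φ))
    A8 : ∀ x t φ → Substitutable t x φ → Instance ((φ [ t / x ]) ∸ sup x φ)
    A9 : ∀ x φ → ¬ FreeIn x φ → Instance (sup x φ ∸ φ)
    A10 : ∀ {m} → metric ≡ just m → ∀ x → Instance (dist m (var x) (var x))
    A11 : ∀ {m} → metric ≡ just m → ∀ x y →
          Instance (dist m (var x) (var y) ∸ dist m (var y) (var x))
    A12 : ∀ {m} → metric ≡ just m → ∀ x y z →
          Instance ((dist m (var x) (var z) ∸ dist m (var x) (var y)) ∸ dist m (var y) (var z))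
    A13 : ∀ {m} → metric ≡ just m → (f : Fun) (i : Fin (arityF f))
          (xs : Vec Var (arityF f)) (z w : Var) {r q : Formula} {rv qv : ℚ} →
          Dyadic r rv → Dyadic q qv → admF f i rv qv →
          Instance ((q ∸ dist m (var z) (var w)) ∧
                    (dist m (app f (map var (xs [ i ]≔ z))) (app f (map var (xs [ i ]≔ w))) ∸ r))
    A14 : ∀ {m} → metric ≡ just m → (P : Rel) (i : Fin (arityR P))
          (xs : Vec Var (arityR P)) (z w : Var) {r q : Formula} {rv qv : ℚ} →
          Dyadic r rv → Dyadic q qv → admR P i rv qv →
          Instance ((q ∸ dist m (var z) (var w)) ∧
                    ((rel P (map var (xs [ i ]≔ z)) ∸ rel P (map var (xs [ i ]≔ w))) ∸ r))

  gen : List Var → Formula → Formula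
  gen []       χ = χ
  gen (x ∷ xs) χ = sup x (gen xs χ)

  data ⊢_ : Formula → Set where
    ax : ∀ xs χ → Instance χ → ⊢ gen xs χ
    mp : ∀ {φ ψ} → ⊢ φ → ⊢ (ψ ∸ φ) → ⊢ ψ

module Submission where

open import Defs
open import Data.Product using (_×_; _,_)
open import Relation.Nullary using (¬_; yes; no)
open import Data.Nat using (_≟_)
open import Data.Vec using (Vec; []; _∷_)
open import Data.List using ([]; _∷_)
open import Data.Empty using (⊥-elim)
open import Function using (_∘_)
open import Relation.Binary.PropositionalEquality
  using (_≡_; _≢_; refl; sym; trans; cong; cong₂; subst)

-- Continuous logic reads 0 as truth, so ⊢ a ∸ b says "a ≤ b"; the proof shows that
-- φ and φ{y/x} are provably ≤ each other by induction on φ, using that every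
-- connective is provably monotone or antitone. The only real work is a quantifier
-- sup_x α, which becomes sup_y α'[y/x] with α' = α{y/x}: (A8) gives
-- α' ≤ sup_y α'[y/x] and α'[y/x] ≤ sup_x α, and (A9) removes the outer quantifier
-- because y does not occur in φ and x is no longer free after renaming.

module SubstitutionLemmas (S : Signature) where
  open Syntax S

  mutual
    substT-fresh : ∀ {x} t s → ¬ x ∈T s → substT t x s ≡ s
    substT-fresh {x} t (var z) x∉ with z ≟ x
    ... | yes refl = ⊥-elim (x∉ here)
    ... | no _ = refl
    substT-fresh t (app f ts) x∉ = cong (app f) (substTs-fresh t ts (x∉ ∘ inApp))

    substTs-fresh : ∀ {x n} t (ss : Vec Term n) → ¬ x ∈Ts ss → substTs t x ss ≡ ss
    substTs-fresh t [] _ = refl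
    substTs-fresh t (s ∷ ss) x∉ =
      cong₂ _∷_ (substT-fresh t s (x∉ ∘ hd)) (substTs-fresh t ss (x∉ ∘ tl))

  mutual
    substT-var-eliminates : ∀ {x y} s → x ≢ y → ¬ x ∈T substT (var y) x s
    substT-var-eliminates {x} (var z) x≢y x∈ with z ≟ x
    substT-var-eliminates (var z) x≢y here | yes _ = x≢y refl
    substT-var-eliminates (var z) x≢y here | no z≢x = z≢x refl
    substT-var-eliminates (app f ts) x≢y (inApp x∈) = substTs-var-eliminates ts x≢y x∈

    substTs-var-eliminates : ∀ {x y n} (ss : Vec Term n) → x ≢ y →
                             ¬ x ∈Ts substTs (var y) x ss
    substTs-var-eliminates (s ∷ ss) x≢y (hd x∈) = substT-var-eliminates s x≢y x∈
    substTs-var-eliminates (s ∷ ss) x≢y (tl x∈) = substTs-var-eliminates ss x≢y x∈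

  mutual
    substT-var-inverse : ∀ {x y} s → x ≢ y → ¬ y ∈T s →
                         substT (var x) y (substT (var y) x s) ≡ s
    substT-var-inverse {x} {y} (var z) x≢y y∉ with z ≟ x
    ... | yes refl with y ≟ y
    ...   | yes _ = refl
    ...   | no y≢y = ⊥-elim (y≢y refl)
    substT-var-inverse {x} {y} (var z) x≢y y∉ | no _ with z ≟ y
    ...   | yes refl = ⊥-elim (y∉ here)
    ...   | no _ = refl
    substT-var-inverse (app f ts) x≢y y∉ = cong (app f) (substTs-var-inverse ts x≢y (y∉ ∘ inApp))

    substTs-var-inverse : ∀ {x y n} (ss : Vec Term n) → x ≢ y → ¬ y ∈Ts ss →
                          substTs (var x) y (substTs (var y) x ss) ≡ ss
    substTs-var-inverse [] _ _ = refl
    substTs-var-inverse (s ∷ ss) x≢y y∉ =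
      cong₂ _∷_ (substT-var-inverse s x≢y (y∉ ∘ hd)) (substTs-var-inverse ss x≢y (y∉ ∘ tl))

  subst-fresh : ∀ {x} t β → ¬ FreeIn x β → β [ t / x ] ≡ β
  subst-fresh t (rel P ts) x∉ = cong (rel P) (substTs-fresh t ts (x∉ ∘ fRel))
  subst-fresh t (a ∸ b) x∉ =
    cong₂ _∸_ (subst-fresh t a (x∉ ∘ fMinL)) (subst-fresh t b (x∉ ∘ fMinR))
  subst-fresh t (neg a) x∉ = cong neg (subst-fresh t a (x∉ ∘ fNeg))
  subst-fresh t (half a) x∉ = cong half (subst-fresh t a (x∉ ∘ fHalf))
  subst-fresh {x} t (sup z a) x∉ with z ≟ x
  ... | yes _ = refl
  ... | no z≢x = cong (sup z) (subst-fresh t a (x∉ ∘ fSup z≢x))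

  subst-var-eliminates : ∀ {x y} β → x ≢ y → ¬ FreeIn x (β [ var y / x ])
  subst-var-eliminates (rel P ts) x≢y (fRel x∈) = substTs-var-eliminates ts x≢y x∈
  subst-var-eliminates (a ∸ b) x≢y (fMinL x∈) = subst-var-eliminates a x≢y x∈
  subst-var-eliminates (a ∸ b) x≢y (fMinR x∈) = subst-var-eliminates b x≢y x∈
  subst-var-eliminates (neg a) x≢y (fNeg x∈) = subst-var-eliminates a x≢y x∈
  subst-var-eliminates (half a) x≢y (fHalf x∈) = subst-var-eliminates a x≢y x∈
  subst-var-eliminates {x} (sup z a) x≢y x∈ with z ≟ x
  subst-var-eliminates (sup z a) x≢y (fSup z≢x _) | yes z≡x = z≢x z≡x
  subst-var-eliminates (sup z a) x≢y (fSup _ x∈) | no _ = subst-var-eliminates a x≢y x∈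

  subst-var-inverse : ∀ {x y} β → x ≢ y → ¬ FreeIn y β → Substitutable (var y) x β →
                      (β [ var y / x ]) [ var x / y ] ≡ β
  subst-var-inverse (rel P ts) x≢y y∉ _ = cong (rel P) (substTs-var-inverse ts x≢y (y∉ ∘ fRel))
  subst-var-inverse (a ∸ b) x≢y y∉ (sMin sa sb) =
    cong₂ _∸_ (subst-var-inverse a x≢y (y∉ ∘ fMinL) sa) (subst-var-inverse b x≢y (y∉ ∘ fMinR) sb)
  subst-var-inverse (neg a) x≢y y∉ (sNeg sa) = cong neg (subst-var-inverse a x≢y (y∉ ∘ fNeg) sa)
  subst-var-inverse (half a) x≢y y∉ (sHalf sa) =
    cong half (subst-var-inverse a x≢y (y∉ ∘ fHalf) sa)
  subst-var-inverse {x} {y} (sup z a) x≢y y∉ s with z ≟ x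
  subst-var-inverse {x} {y} (sup z a) x≢y y∉ s | yes refl with z ≟ y
  ... | yes z≡y = ⊥-elim (x≢y z≡y)
  ... | no z≢y = cong (sup z) (subst-fresh (var z) a (y∉ ∘ fSup z≢y))
  subst-var-inverse {x} {y} (sup z a) x≢y y∉ s | no z≢x with z ≟ y
  subst-var-inverse (sup z a) x≢y y∉ sSupSame | no z≢x | _ = ⊥-elim (z≢x refl)
  subst-var-inverse (sup z a) x≢y y∉ (sSupNF x∉) | no z≢x | yes refl =
    cong (sup z) (subst-fresh (var z) a x∉)
  subst-var-inverse (sup z a) x≢y y∉ (sSup z∉ _) | no z≢x | yes refl = ⊥-elim (z∉ here)
  subst-var-inverse {x} {y} (sup z a) x≢y y∉ (sSupNF x∉) | no z≢x | no z≢y =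
    cong (sup z) (trans (cong (_[ var x / y ]) (subst-fresh (var y) a x∉))
                        (subst-fresh (var x) a (y∉ ∘ fSup z≢y)))
  subst-var-inverse (sup z a) x≢y y∉ (sSup _ sa) | no z≢x | no z≢y =
    cong (sup z) (subst-var-inverse a x≢y (y∉ ∘ fSup z≢y) sa)

  data NotBound (x : Var) : Formula → Set where
    nbRel  : ∀ {P ts} → NotBound x (rel P ts)
    nbMin  : ∀ {a b} → NotBound x a → NotBound x b → NotBound x (a ∸ b)
    nbNeg  : ∀ {a} → NotBound x a → NotBound x (neg a)
    nbHalf : ∀ {a} → NotBound x a → NotBound x (half a)
    nbSup  : ∀ {z a} → z ≢ x → NotBound x a → NotBound x (sup z a)

  subst-NotBound : ∀ {x} t v β → NotBound x β → NotBound x (β [ t / v ])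
  subst-NotBound t v (rel P ts) _ = nbRel
  subst-NotBound t v (a ∸ b) (nbMin na nb) =
    nbMin (subst-NotBound t v a na) (subst-NotBound t v b nb)
  subst-NotBound t v (neg a) (nbNeg na) = nbNeg (subst-NotBound t v a na)
  subst-NotBound t v (half a) (nbHalf na) = nbHalf (subst-NotBound t v a na)
  subst-NotBound t v (sup z a) (nbSup z≢x na) with z ≟ v
  ... | yes _ = nbSup z≢x na
  ... | no _ = nbSup z≢x (subst-NotBound t v a na)

  NotBound⇒Substitutable : ∀ {x} v β → NotBound x β → Substitutable (var x) v β
  NotBound⇒Substitutable v (rel P ts) _ = sRel
  NotBound⇒Substitutable v (a ∸ b) (nbMin na nb) =
    sMin (NotBound⇒Substitutable v a na) (NotBound⇒Substitutable v b nb)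
  NotBound⇒Substitutable v (neg a) (nbNeg na) = sNeg (NotBound⇒Substitutable v a na)
  NotBound⇒Substitutable v (half a) (nbHalf na) = sHalf (NotBound⇒Substitutable v a na)
  NotBound⇒Substitutable v (sup z a) (nbSup z≢x na) =
    sSup (λ { here → z≢x refl }) (NotBound⇒Substitutable v a na)

  ¬Occurs⇒¬FreeIn : ∀ {y} α → ¬ Occurs y α → ¬ FreeIn y α
  ¬Occurs⇒¬FreeIn (rel P ts) y∉ (fRel y∈) = y∉ (oRel y∈)
  ¬Occurs⇒¬FreeIn (a ∸ b) y∉ (fMinL y∈) = ¬Occurs⇒¬FreeIn a (y∉ ∘ oMinL) y∈
  ¬Occurs⇒¬FreeIn (a ∸ b) y∉ (fMinR y∈) = ¬Occurs⇒¬FreeIn b (y∉ ∘ oMinR) y∈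
  ¬Occurs⇒¬FreeIn (neg a) y∉ (fNeg y∈) = ¬Occurs⇒¬FreeIn a (y∉ ∘ oNeg) y∈
  ¬Occurs⇒¬FreeIn (half a) y∉ (fHalf y∈) = ¬Occurs⇒¬FreeIn a (y∉ ∘ oHalf) y∈
  ¬Occurs⇒¬FreeIn (sup z a) y∉ (fSup _ y∈) = ¬Occurs⇒¬FreeIn a (y∉ ∘ oSup) y∈

  ¬Occurs⇒Substitutable : ∀ {x y} α → ¬ Occurs y α → Substitutable (var y) x α
  ¬Occurs⇒Substitutable (rel P ts) _ = sRel
  ¬Occurs⇒Substitutable (a ∸ b) y∉ =
    sMin (¬Occurs⇒Substitutable a (y∉ ∘ oMinL)) (¬Occurs⇒Substitutable b (y∉ ∘ oMinR))
  ¬Occurs⇒Substitutable (neg a) y∉ = sNeg (¬Occurs⇒Substitutable a (y∉ ∘ oNeg))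
  ¬Occurs⇒Substitutable (half a) y∉ = sHalf (¬Occurs⇒Substitutable a (y∉ ∘ oHalf))
  ¬Occurs⇒Substitutable (sup z a) y∉ =
    sSup (λ { here → y∉ oBind }) (¬Occurs⇒Substitutable a (y∉ ∘ oSup))

  rename-NotBound : ∀ {x y} β → x ≢ y → NotBound x (β ⟪ y / x ⟫)
  rename-NotBound (rel P ts) _ = nbRel
  rename-NotBound (a ∸ b) x≢y = nbMin (rename-NotBound a x≢y) (rename-NotBound b x≢y)
  rename-NotBound (neg a) x≢y = nbNeg (rename-NotBound a x≢y)
  rename-NotBound (half a) x≢y = nbHalf (rename-NotBound a x≢y)
  rename-NotBound {x} {y} (sup z a) x≢y with z ≟ x
  ... | yes _ =
    nbSup (x≢y ∘ sym) (subst-NotBound (var y) x (a ⟪ y / x ⟫) (rename-NotBound a x≢y))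
  ... | no z≢x = nbSup z≢x (rename-NotBound a x≢y)

  rename-¬FreeIn : ∀ {x y} α → ¬ Occurs y α → ¬ FreeIn y (α ⟪ y / x ⟫)
  rename-¬FreeIn (rel P ts) y∉ (fRel y∈) = y∉ (oRel y∈)
  rename-¬FreeIn (a ∸ b) y∉ (fMinL y∈) = rename-¬FreeIn a (y∉ ∘ oMinL) y∈
  rename-¬FreeIn (a ∸ b) y∉ (fMinR y∈) = rename-¬FreeIn b (y∉ ∘ oMinR) y∈
  rename-¬FreeIn (neg a) y∉ (fNeg y∈) = rename-¬FreeIn a (y∉ ∘ oNeg) y∈
  rename-¬FreeIn (half a) y∉ (fHalf y∈) = rename-¬FreeIn a (y∉ ∘ oHalf) y∈
  rename-¬FreeIn {x} (sup z a) y∉ y∈ with z ≟ x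
  rename-¬FreeIn (sup z a) y∉ (fSup y≢y _) | yes _ = y≢y refl
  rename-¬FreeIn (sup z a) y∉ (fSup _ y∈) | no _ = rename-¬FreeIn a (y∉ ∘ oSup) y∈

  rename-Substitutable : ∀ {x y} α → x ≢ y → ¬ Occurs y α →
                         Substitutable (var y) x (α ⟪ y / x ⟫)
  rename-Substitutable (rel P ts) _ _ = sRel
  rename-Substitutable (a ∸ b) x≢y y∉ =
    sMin (rename-Substitutable a x≢y (y∉ ∘ oMinL)) (rename-Substitutable b x≢y (y∉ ∘ oMinR))
  rename-Substitutable (neg a) x≢y y∉ = sNeg (rename-Substitutable a x≢y (y∉ ∘ oNeg))
  rename-Substitutable (half a) x≢y y∉ = sHalf (rename-Substitutable a x≢y (y∉ ∘ oHalf))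
  rename-Substitutable {x} {y} (sup z a) x≢y y∉ with z ≟ x
  ... | yes _ = sSupNF (subst-var-eliminates (a ⟪ y / x ⟫) x≢y)
  ... | no _ = sSup (λ { here → y∉ oBind }) (rename-Substitutable a x≢y (y∉ ∘ oSup))

module ProvableOrder (S : Signature) where
  open Syntax S

  axiom : ∀ {χ} → Instance χ → ⊢ χ
  axiom = ax [] _

  infix 4 _≼_ _≈_
  _≼_ : Formula → Formula → Set
  a ≼ b = ⊢ (a ∸ b)

  _≈_ : Formula → Formula → Set
  a ≈ b = a ≼ b × b ≼ a

  ⊢-antitone : ∀ {a b} → a ≼ b → ⊢ b → ⊢ a
  ⊢-antitone a≼b ⊢b = mp ⊢b a≼b

  ≼-trans : ∀ {a b c} → a ≼ b → b ≼ c → a ≼ c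
  ≼-trans {a} {b} {c} a≼b b≼c = mp a≼b (mp b≼c (axiom (A2 c b a)))

  ∸-decreasing : ∀ a b → a ∸ b ≼ a
  ∸-decreasing a b = axiom (A1 a b)

  ∸-antitoneʳ : ∀ a {b b'} → b' ≼ b → a ∸ b ≼ a ∸ b'
  ∸-antitoneʳ a {b} {b'} b'≼b = mp b'≼b (axiom (A2 b b' a))

  ∧-comm : ∀ a b → a ∧ b ≼ b ∧ a
  ∧-comm a b = axiom (A3 a b)

  ∧-lowerˡ : ∀ a b → a ∧ b ≼ a
  ∧-lowerˡ a b = ∸-decreasing a (a ∸ b)

  ∧-lowerʳ : ∀ a b → a ∧ b ≼ b
  ∧-lowerʳ a b = ≼-trans (∧-comm a b) (∧-lowerˡ b a)

  ∧-provable : ∀ a {b} → ⊢ b → ⊢ (a ∧ b)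
  ∧-provable a {b} = ⊢-antitone (∧-lowerʳ a b)

  ≼-∧-self : ∀ {a b} → a ≼ b → a ≼ a ∧ b
  ≼-∧-self {a} = ∧-provable a

  -- (a ∸ a) ∸ (a ∧ t) ≤ (a ∸ t) ∸ a by (A2), and both a ∸ t ≤ a and a ∧ t are provable.
  ≼-refl : ∀ a → a ≼ a
  ≼-refl a = ⊢-antitone (mp (axiom (A1 a t)) (axiom (A2 a (a ∸ t) a)))
                        (∧-provable a (axiom (A1 a a)))
    where t = (a ∸ a) ∸ a

  ∸-exchange : ∀ a b c → (a ∸ b) ∸ c ≼ (a ∸ c) ∸ b
  ∸-exchange a b c = ≼-trans (∸-antitoneʳ (a ∸ b) (∧-lowerʳ a c)) (axiom (A2 b (a ∸ c) a))

  ∸-residual : ∀ {a b c} → a ∸ b ≼ c → a ∸ c ≼ b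
  ∸-residual {a} {b} {c} = ⊢-antitone (∸-exchange a c b)

  ∸-monotoneˡ : ∀ {a a'} b → a ≼ a' → a ∸ b ≼ a' ∸ b
  ∸-monotoneˡ {a} {a'} b = ⊢-antitone (∸-residual (axiom (A2 b a' a)))

  ∧-greatest : ∀ {c a b} → c ≼ a → c ≼ b → c ≼ a ∧ b
  ∧-greatest {c} {a} c≼a c≼b =
    ≼-trans (≼-∧-self c≼a) (≼-trans (∧-comm c a) (∸-antitoneʳ a (∸-antitoneʳ a c≼b)))

  ≼-∸-flip : ∀ {a c j} → a ≼ j → c ≼ j ∸ a → a ≼ j ∸ c
  ≼-∸-flip {a} {c} {j} a≼j c≼j∸a =
    ≼-trans (≼-∧-self a≼j) (≼-trans (∧-comm a j) (∸-antitoneʳ j c≼j∸a))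

  𝟙 : Formula → Formula
  𝟙 e = neg (e ∸ e)

  ∸-≼-neg : ∀ a b → b ∸ a ≼ neg a
  ∸-≼-neg a b = ≼-trans (axiom (A4 b a)) (∸-decreasing (neg a) (neg b))

  ≼-𝟙 : ∀ e a → a ≼ 𝟙 e
  ≼-𝟙 e a = ≼-trans (∧-provable a (≼-refl e)) (∸-≼-neg (e ∸ e) a)

  𝟙-∧-≼ : ∀ e a → 𝟙 e ∧ a ≼ a
  𝟙-∧-≼ e = ∧-lowerʳ (𝟙 e)

  ≼-𝟙-∧ : ∀ e a → a ≼ 𝟙 e ∧ a
  ≼-𝟙-∧ e a = ≼-trans (≼-∧-self (≼-𝟙 e a)) (∧-comm a (𝟙 e))

  neg-≼-𝟙∸ : ∀ e a → neg a ≼ 𝟙 e ∸ a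
  neg-≼-𝟙∸ e a = ≼-trans (≼-𝟙-∧ e (neg a)) (∸-antitoneʳ (𝟙 e) a≼𝟙∸neg)
    where
      a≼𝟙∸neg : a ≼ 𝟙 e ∸ neg a
      a≼𝟙∸neg = ≼-trans (∧-provable a (≼-refl e)) (axiom (A4 a (e ∸ e)))

  neg-antitone : ∀ {a a'} → a' ≼ a → neg a ≼ neg a'
  neg-antitone {a} {a'} a'≼a =
    ≼-trans (neg-≼-𝟙∸ a a) (≼-trans (∸-antitoneʳ (𝟙 a) a'≼a) (∸-≼-neg a' (𝟙 a)))

  join : Formula → Formula → Formula → Formula
  join e a b = 𝟙 e ∸ ((𝟙 e ∸ a) ∧ (𝟙 e ∸ b))

  join-upperˡ : ∀ e a b → a ≼ join e a b
  join-upperˡ e a b = ≼-trans (≼-𝟙-∧ e a) (∸-antitoneʳ (𝟙 e) (∧-lowerˡ _ _))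

  join-upperʳ : ∀ e a b → b ≼ join e a b
  join-upperʳ e a b = ≼-trans (≼-𝟙-∧ e b) (∸-antitoneʳ (𝟙 e) (∧-lowerʳ _ _))

  join-least : ∀ {e a b c} → a ≼ c → b ≼ c → join e a b ≼ c
  join-least {e} {c = c} a≼c b≼c =
    ≼-trans (∸-antitoneʳ (𝟙 e) (∧-greatest (∸-antitoneʳ (𝟙 e) a≼c) (∸-antitoneʳ (𝟙 e) b≼c)))
            (𝟙-∧-≼ e c)

  -- With j = max(x, y) and g = min(j ∸ x, j ∸ y): j ≤ j ∸ g since both x and y are,
  -- which together with g ≤ j forces g = 0; and min(x ∸ y, y ∸ x) ≤ g.
  prelinearity : ∀ x y → ⊢ ((x ∸ y) ∧ (y ∸ x))
  prelinearity x y = ⊢-antitone (∧-greatest lhs≼j∸x lhs≼j∸y) ⊢g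
    where
      j = join x x y
      g = (j ∸ x) ∧ (j ∸ y)

      lhs≼j∸x : (x ∸ y) ∧ (y ∸ x) ≼ j ∸ x
      lhs≼j∸x = ≼-trans (∧-lowerʳ _ _) (∸-monotoneˡ x (join-upperʳ x x y))

      lhs≼j∸y : (x ∸ y) ∧ (y ∸ x) ≼ j ∸ y
      lhs≼j∸y = ≼-trans (∧-lowerˡ _ _) (∸-monotoneˡ y (join-upperˡ x x y))

      j≼j∸g : j ≼ j ∸ g
      j≼j∸g = join-least (≼-∸-flip (join-upperˡ x x y) (∧-lowerˡ _ _))
                         (≼-∸-flip (join-upperʳ x x y) (∧-lowerʳ _ _))

      ⊢g : ⊢ g
      ⊢g = ⊢-antitone (≼-∸-flip (≼-trans (∧-lowerˡ _ _) (∸-decreasing j x)) j≼j∸g) (≼-refl j)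

  -- (A5) and (A6) only give half u ∸ half v ≤ half v ∸ half u; prelinearity then makes it 0.
  half-monotone : ∀ {u v} → u ≼ v → half u ≼ half v
  half-monotone {u} {v} u≼v = mp x∸y≼y∸x (prelinearity x y)
    where
      x = half u
      y = half v
      x∸y≼y∸x : x ∸ y ≼ y ∸ x
      x∸y≼y∸x = ≼-trans (∸-monotoneˡ y (≼-trans (axiom (A5 u)) (∸-monotoneˡ x u≼v)))
                        (≼-trans (∸-exchange v x y) (∸-monotoneˡ x (axiom (A6 v))))

  generalisation : ∀ x {φ} → ⊢ φ → ⊢ sup x φ
  generalisation x (ax xs χ i) = ax (x ∷ xs) χ i
  generalisation x (mp {φ} {ψ} ⊢φ ⊢ψ∸φ) =
    mp (generalisation x ⊢φ) (mp (generalisation x ⊢ψ∸φ) (axiom (A7 x φ ψ)))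

  sup-monotone : ∀ x {a b} → a ≼ b → sup x a ≼ sup x b
  sup-monotone x {a} {b} a≼b = mp (generalisation x a≼b) (axiom (A7 x b a))

  sup-least : ∀ {x a b} → ¬ FreeIn x b → a ≼ b → sup x a ≼ b
  sup-least {x} {b = b} x∉b a≼b = ≼-trans (sup-monotone x a≼b) (axiom (A9 x b x∉b))

  instance-≼-sup : ∀ {x t a} → Substitutable t x a → a [ t / x ] ≼ sup x a
  instance-≼-sup {x} {t} {a} s = axiom (A8 x t a s)

  ⊢-instantiate : ∀ {x t a} → Substitutable t x a → ⊢ a → ⊢ (a [ t / x ])
  ⊢-instantiate {x} s ⊢a = ⊢-antitone (instance-≼-sup s) (generalisation x ⊢a)

  ≈-refl : ∀ a → a ≈ a
  ≈-refl a = ≼-refl a , ≼-refl a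

  ∸-cong : ∀ {a a' b b'} → a ≈ a' → b ≈ b' → a ∸ b ≈ a' ∸ b'
  ∸-cong {a} {a'} {b} {b'} (a≼a' , a'≼a) (b≼b' , b'≼b) =
    ≼-trans (∸-monotoneˡ b a≼a') (∸-antitoneʳ a' b'≼b) ,
    ≼-trans (∸-monotoneˡ b' a'≼a) (∸-antitoneʳ a b≼b')

  neg-cong : ∀ {a a'} → a ≈ a' → neg a ≈ neg a'
  neg-cong (a≼a' , a'≼a) = neg-antitone a'≼a , neg-antitone a≼a'

  half-cong : ∀ {a a'} → a ≈ a' → half a ≈ half a'
  half-cong (a≼a' , a'≼a) = half-monotone a≼a' , half-monotone a'≼a

  sup-cong : ∀ x {a a'} → a ≈ a' → sup x a ≈ sup x a'
  sup-cong x (a≼a' , a'≼a) = sup-monotone x a≼a' , sup-monotone x a'≼a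

module AlphaConversion (S : Signature) where
  open Syntax S
  open SubstitutionLemmas S
  open ProvableOrder S

  sup-rename-≈ : ∀ {x y} α → ¬ Occurs y (sup x α) → α ≈ α ⟪ y / x ⟫ →
                 sup x α ≈ sup y ((α ⟪ y / x ⟫) [ var y / x ])
  sup-rename-≈ {x} {y} α y∉ (α≼α' , α'≼α) =
    sup-least x∉sup-α'' (≼-trans α≼α' α'≼sup-α'') ,
    sup-least y∉sup-α (≼-trans α''≼α[y/x] (instance-≼-sup y-for-x-in-α))
    where
      x≢y : x ≢ y
      x≢y refl = y∉ oBind

      y∉α : ¬ Occurs y α
      y∉α = y∉ ∘ oSup

      α' = α ⟪ y / x ⟫
      α'' = α' [ var y / x ]

      y-for-x-in-α : Substitutable (var y) x α
      y-for-x-in-α = ¬Occurs⇒Substitutable α y∉α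

      y-for-x-in-α' : Substitutable (var y) x α'
      y-for-x-in-α' = rename-Substitutable α x≢y y∉α

      x-for-y-in-α'' : Substitutable (var x) y α''
      x-for-y-in-α'' =
        NotBound⇒Substitutable y α'' (subst-NotBound (var y) x α' (rename-NotBound α x≢y))

      -- α' is the instance α''[x/y] of sup_y α''.
      α'≼sup-α'' : α' ≼ sup y α''
      α'≼sup-α'' =
        subst (_≼ sup y α'') (subst-var-inverse α' x≢y (rename-¬FreeIn α y∉α) y-for-x-in-α')
              (instance-≼-sup x-for-y-in-α'')

      α''≼α[y/x] : α'' ≼ α [ var y / x ]
      α''≼α[y/x] = ⊢-instantiate (sMin y-for-x-in-α' y-for-x-in-α) α'≼α

      x∉sup-α'' : ¬ FreeIn x (sup y α'')
      x∉sup-α'' (fSup _ x∈) = subst-var-eliminates α' x≢y x∈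

      y∉sup-α : ¬ FreeIn y (sup x α)
      y∉sup-α = ¬Occurs⇒¬FreeIn (sup x α) y∉

  rename-≈ : ∀ φ x y → ¬ Occurs y φ → φ ≈ φ ⟪ y / x ⟫
  rename-≈ (rel P ts) x y _ = ≈-refl (rel P ts)
  rename-≈ (a ∸ b) x y y∉ =
    ∸-cong (rename-≈ a x y (y∉ ∘ oMinL)) (rename-≈ b x y (y∉ ∘ oMinR))
  rename-≈ (neg a) x y y∉ = neg-cong (rename-≈ a x y (y∉ ∘ oNeg))
  rename-≈ (half a) x y y∉ = half-cong (rename-≈ a x y (y∉ ∘ oHalf))
  rename-≈ (sup z a) x y y∉ with z ≟ x
  ... | yes refl = sup-rename-≈ a y∉ (rename-≈ a z y (y∉ ∘ oSup))
  ... | no _ = sup-cong z (rename-≈ a x y (y∉ ∘ oSup))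

lemma8p3 : (S : Signature) → let open Syntax S in
    (φ : Formula) (x y : Var) → ¬ Occurs y φ →
    (⊢ (φ ∸ (φ ⟪ y / x ⟫))) × (⊢ ((φ ⟪ y / x ⟫) ∸ φ))
lemma8p3 S = AlphaConversion.rename-≈ S
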